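{- Let $\Sigma$ be a finite CW complex of dimension $d$ and let $\Upsilon=\{\sigma_1,\dots,\sigma_r\}$ be a cellular spanning forest of $\Sigma$. For $\sigma=\sigma_i\in\Upsilon$ define $$\bar\chi(\Upsilon,\sigma)=\sum_{j=1}^r(-1)^j\big(\det L^{\mathrm{du}}_{\Upsilon\setminus\sigma,\ \Upsilon\setminus\sigma_j}\big)\,L^{\mathrm{du}}\sigma_j\ \in C_d(\Sigma;\mathbb{R}).$$ Then $\{\bar\chi(\Upsilon,\sigma):\sigma\in\Upsilon\}$ is an $\mathbb{R}$-vector space basis of the cut space $\operatorname{Cut}_d(\Sigma)=\operatorname{im}(\partial_d^*:C_{d-1}(\Sigma;\mathbb{R})\to C_d(\Sigma;\mathbb{R}))$.
   Context: $\Sigma$ has the convention of a unique $(-1)$-cell; $d$-cells are facets; cells are oriented and $\partial_d$ is the cellular boundary map with transpose $\partial_d^*$; $r=\operatorname{rank}\partial_d$. A cellular spanning forest (CSF) is a subcomplex $\Upsilon$ containing the full $(d-1)$-skeleton of $\Sigma$, identified with its set of facets, whose facets index a basis of the column space of $\partial_d$ over $\mathbb{R}$ (so $|\Upsilon|=r$). $L^{\mathrm{du}}=\partial_d^*\partial_d$ is the down-up Laplacian on $C_d(\Sigma;\mathbb{R})$, a matrix indexed by facets; $L^{\mathrm{du}}_{X,Y}$ is its submatrix with rows $X$ and columns $Y$, both ordered by the indexing $\sigma_1,\dots,\sigma_r$; facets are identified with basis vectors of $C_d(\Sigma;\mathbb{R})$.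
   Formalization: The coefficient field is ℚ rather than ℝ, for the chains, the column space of ∂_d defining cellular spanning forests, and the cut space with its basis. -}

module Defs where

open import Data.Nat as ℕ using (ℕ; zero; suc; _<_)
open import Data.Fin using (Fin; zero; suc; toℕ; punchIn)
open import Data.Integer as ℤ using (ℤ)
open import Data.Rational as ℚ using (ℚ; 0ℚ; 1ℚ; _+_; _*_; -_)
open import Data.Product using (Σ; ∃; _×_; _,_)
open import Relation.Binary.PropositionalEquality using (_≡_)

∑ℤ : {n : ℕ} → (Fin n → ℤ) → ℤ
∑ℤ {zero}  f = ℤ.+ 0
∑ℤ {suc n} f = f zero ℤ.+ ∑ℤ (λ i → f (suc i))

∑ : {n : ℕ} → (Fin n → ℚ) → ℚ
∑ {zero}  f = 0ℚ
∑ {suc n} f = f zero + ∑ (λ i → f (suc i))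

sign : ℕ → ℚ
sign zero    = 1ℚ
sign (suc k) = - sign k

fromℤ : ℤ → ℚ
fromℤ z = z ℚ./ 1

Vecℚ : ℕ → Set
Vecℚ n = Fin n → ℚ

Mat : ℕ → ℕ → Set
Mat m n = Fin m → Fin n → ℚ

det : {n : ℕ} → Mat n n → ℚ
det {zero}  M = 1ℚ
det {suc n} M =
  ∑ (λ j → sign (toℕ j) * (M zero j * det (λ a b → M (suc a) (punchIn j b))))

lincomb : {k n : ℕ} → (Fin k → ℚ) → (Fin k → Vecℚ n) → Vecℚ n
lincomb c v x = ∑ (λ i → c i * v i x)

LinIndep : {k n : ℕ} → (Fin k → Vecℚ n) → Set
LinIndep v = ∀ c → (∀ x → lincomb c v x ≡ 0ℚ) → ∀ i → c i ≡ 0ℚ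

IsBasisOf : {k n : ℕ} → (Vecℚ n → Set) → (Fin k → Vecℚ n) → Set
IsBasisOf W v =
  (∀ i → W (v i)) × LinIndep v ×
  (∀ u → W u → Σ (Fin _ → ℚ) (λ c → ∀ x → u x ≡ lincomb c v x))

-- Augmented cellular chain complex of a finite CW complex of dimension d.
-- Index shift: cells k = number of (k-1)-cells (so cells 0 = the
-- (-1)-cells, cells (suc d) = the d-cells = facets).
-- bd k σ τ = coefficient of the (k-1)-cell τ in ∂ of the k-cell σ.

record CellComplex (d : ℕ) : Set where
  field
    cells       : ℕ → ℕ
    unique-⁻¹   : cells 0 ≡ 1
    has-facet   : 0 < cells (suc d)
    no-higher   : ∀ k → suc d < k → cells k ≡ 0
    bd          : (k : ℕ) → Fin (cells (suc k)) → Fin (cells k) → ℤ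
    augmentation : ∀ v τ → bd 0 v τ ≡ ℤ.+ 1
    bd∘bd       : ∀ k σ ρ →
                  ∑ℤ (λ τ → bd (suc k) σ τ ℤ.* bd k τ ρ) ≡ ℤ.+ 0

module _ {d : ℕ} (Σc : CellComplex d) where
  open CellComplex Σc

  nF : ℕ
  nF = cells (suc d)

  nR : ℕ
  nR = cells d

  ∂d : Fin nF → Fin nR → ℚ
  ∂d σ ρ = fromℤ (bd d σ ρ)

  ∂col : Fin nF → Vecℚ nR
  ∂col σ ρ = ∂d σ ρ

  ColSpace : Vecℚ nR → Set
  ColSpace u = ∃ λ (a : Vecℚ nF) → ∀ ρ → u ρ ≡ lincomb a ∂col ρ

  IsCSF : {r : ℕ} → (Fin r → Fin nF) → Set
  IsCSF Υ = IsBasisOf ColSpace (λ i → ∂col (Υ i))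

  Cut : Vecℚ nF → Set
  Cut v = ∃ λ (w : Vecℚ nR) → ∀ σ → v σ ≡ ∑ (λ ρ → ∂d σ ρ * w ρ)

  Ldu : Mat nF nF
  Ldu σ τ = ∑ (λ ρ → ∂d σ ρ * ∂d τ ρ)

  LduOn : Fin nF → Vecℚ nF
  LduOn σ τ = Ldu τ σ

  -- χ̄(Υ, σᵢ) = ∑_{j=1}^r (-1)^j det L_{Υ∖σᵢ, Υ∖σⱼ} · L σⱼ   (j 1-based)
  χ̄ : {r : ℕ} → (Fin r → Fin nF) → Fin r → Vecℚ nF
  χ̄ {suc r} Υ i =
    lincomb (λ j → sign (suc (toℕ j)) *
                   det (λ a b → Ldu (Υ (punchIn i a)) (Υ (punchIn j b))))
            (λ j → LduOn (Υ j))

-- Let G be the Gram matrix (∂σᵢ · ∂σⱼ) of the boundaries of the forest facets; it is the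
-- restriction of L^du to Υ × Υ. The coefficients of χ̄(Υ, σᵢ) form the i-th cofactor row of G,
-- so by Laplace expansion χ̄(Υ, σᵢ) vanishes at every forest facet σₖ with k ≠ i and equals
-- ±det G at σᵢ, and det G ≠ 0 because the ∂σⱼ are independent and the dot product is
-- positive definite. Each L^du σ = ∂*(∂σ) is a cut vector, hence so is each χ̄(Υ, σᵢ), and the
-- triangular evaluation makes them independent. They span because a cut vector ∂*w is
-- determined by its values on Υ: every ∂σ is a combination of the ∂σⱼ, hence (∂*w)(σ) = ∂σ · w
-- is the same combination of the values (∂*w)(σⱼ).

module Submission where

open import Defs
open import Algebra.Bundles using (CommutativeRing)
import Algebra.Properties.Semiring.Sum as SemiringSum
open import Data.Empty using (⊥-elim)
open import Data.Fin using (Fin; zero; suc; toℕ; punchIn; punchOut)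
open import Data.Fin.Properties
  using (punchInᵢ≢i; punchIn-punchOut; punchOut-punchIn; punchOut-cong)
  renaming (_≟_ to _≟ᶠ_)
open import Data.Nat using (ℕ; zero; suc)
open import Data.Product using (Σ; _,_; proj₁; proj₂)
open import Data.Rational using (ℚ; 0ℚ; 1ℚ; _+_; _*_; -_; _≤_; 1/_; ½; ≢-nonZero; nonNegative; nonPositive)
import Data.Rational.Properties as ℚ
open import Data.Rational.Solver using (module +-*-Solver)
open import Data.Sum using (inj₁; inj₂)
open import Data.Vec.Functional using (_∷_; removeAt)
open import Function using (_∘_; flip)
open import Relation.Nullary using (yes; no)
open import Relation.Binary.PropositionalEquality
open ≡-Reasoning
open +-*-Solver

module Sum = SemiringSum (CommutativeRing.semiring ℚ.+-*-commutativeRing)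

∑≡sum : ∀ {n} (f : Fin n → ℚ) → ∑ f ≡ Sum.sum f
∑≡sum {zero}  f = refl
∑≡sum {suc n} f = cong (f zero +_) (∑≡sum (f ∘ suc))

∑-cong : ∀ {n} {f g : Fin n → ℚ} → (∀ i → f i ≡ g i) → ∑ f ≡ ∑ g
∑-cong {zero}  f≗g = refl
∑-cong {suc n} f≗g = cong₂ _+_ (f≗g zero) (∑-cong (f≗g ∘ suc))

∑-zero : ∀ {n} {f : Fin n → ℚ} → (∀ i → f i ≡ 0ℚ) → ∑ f ≡ 0ℚ
∑-zero {zero}  f≗0 = refl
∑-zero {suc n} f≗0 = cong₂ _+_ (f≗0 zero) (∑-zero (f≗0 ∘ suc))

∑-neg : ∀ {n} (f : Fin n → ℚ) → ∑ (λ i → - f i) ≡ - ∑ f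
∑-neg {zero}  f = refl
∑-neg {suc n} f = trans (cong (- f zero +_) (∑-neg (f ∘ suc)))
                        (sym (ℚ.neg-distrib-+ (f zero) (∑ (f ∘ suc))))

*-distribˡ-∑ : ∀ {n} x (f : Fin n → ℚ) → x * ∑ f ≡ ∑ (λ i → x * f i)
*-distribˡ-∑ x f = trans (cong (x *_) (∑≡sum f))
                         (trans (Sum.*-distribˡ-sum x f) (sym (∑≡sum (λ i → x * f i))))

∑-comm : ∀ {m n} (f : Fin m → Fin n → ℚ) →
         ∑ (λ i → ∑ (λ j → f i j)) ≡ ∑ (λ j → ∑ (λ i → f i j))
∑-comm f = trans (∑∑≡sum-sum f) (trans (Sum.∑-comm f) (sym (∑∑≡sum-sum (flip f))))
  where
  ∑∑≡sum-sum : ∀ {m n} (g : Fin m → Fin n → ℚ) →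
               ∑ (λ i → ∑ (g i)) ≡ Sum.sum (λ i → Sum.sum (g i))
  ∑∑≡sum-sum g = trans (∑-cong (∑≡sum ∘ g)) (∑≡sum (λ i → Sum.sum (g i)))

∑-remove : ∀ {n} (f : Fin (suc n) → ℚ) k → ∑ f ≡ f k + ∑ (f ∘ punchIn k)
∑-remove f k = trans (∑≡sum f)
  (trans (Sum.sum-remove {i = k} f) (sym (cong (f k +_) (∑≡sum (f ∘ punchIn k)))))

∑-supported-at : ∀ {n} (f : Fin n → ℚ) k → (∀ i → i ≢ k → f i ≡ 0ℚ) → ∑ f ≡ f k
∑-supported-at {suc n} f k f≗0 = begin
  ∑ f                        ≡⟨ ∑-remove f k ⟩
  f k + ∑ (f ∘ punchIn k)    ≡⟨ cong (f k +_) (∑-zero (λ a → f≗0 (punchIn k a) (punchInᵢ≢i k a))) ⟩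
  f k + 0ℚ                   ≡⟨ ℚ.+-identityʳ (f k) ⟩
  f k                        ∎

infix 7 _·_

_·_ : ∀ {m} → Vecℚ m → Vecℚ m → ℚ
u · w = ∑ (λ ρ → u ρ * w ρ)

·-comm : ∀ {m} (u w : Vecℚ m) → u · w ≡ w · u
·-comm u w = ∑-cong (λ ρ → ℚ.*-comm (u ρ) (w ρ))

·-congˡ : ∀ {m} {u u′ : Vecℚ m} (w : Vecℚ m) → (∀ ρ → u ρ ≡ u′ ρ) → u · w ≡ u′ · w
·-congˡ w u≗u′ = ∑-cong (λ ρ → cong (_* w ρ) (u≗u′ ρ))

·-lincombʳ : ∀ {m k} (u : Vecℚ m) (c : Fin k → ℚ) (v : Fin k → Vecℚ m) →
             u · lincomb c v ≡ ∑ (λ j → c j * (u · v j))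
·-lincombʳ u c v = begin
  ∑ (λ ρ → u ρ * ∑ (λ j → c j * v j ρ))      ≡⟨ ∑-cong (λ ρ → *-distribˡ-∑ (u ρ) (λ j → c j * v j ρ)) ⟩
  ∑ (λ ρ → ∑ (λ j → u ρ * (c j * v j ρ)))    ≡⟨ ∑-comm (λ ρ j → u ρ * (c j * v j ρ)) ⟩
  ∑ (λ j → ∑ (λ ρ → u ρ * (c j * v j ρ)))    ≡⟨ ∑-cong (λ j → ∑-cong (λ ρ → x[yz]≡y[xz] (u ρ) (c j) (v j ρ))) ⟩
  ∑ (λ j → ∑ (λ ρ → c j * (u ρ * v j ρ)))    ≡⟨ ∑-cong (λ j → sym (*-distribˡ-∑ (c j) (λ ρ → u ρ * v j ρ))) ⟩
  ∑ (λ j → c j * (u · v j))                  ∎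
  where
  x[yz]≡y[xz] : ∀ x y z → x * (y * z) ≡ y * (x * z)
  x[yz]≡y[xz] = solve 3 (λ x y z → x :* (y :* z) := y :* (x :* z)) refl

·-lincombˡ : ∀ {m k} (c : Fin k → ℚ) (v : Fin k → Vecℚ m) (w : Vecℚ m) →
             lincomb c v · w ≡ ∑ (λ j → c j * (v j · w))
·-lincombˡ c v w = begin
  lincomb c v · w               ≡⟨ ·-comm (lincomb c v) w ⟩
  w · lincomb c v               ≡⟨ ·-lincombʳ w c v ⟩
  ∑ (λ j → c j * (w · v j))     ≡⟨ ∑-cong (λ j → cong (c j *_) (·-comm w (v j))) ⟩
  ∑ (λ j → c j * (v j · w))     ∎

x≡-x⇒x≡0 : ∀ x → x ≡ - x → x ≡ 0ℚ
x≡-x⇒x≡0 x x≡-x = begin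
  x              ≡⟨ solve 1 (λ x → x := (x :+ x) :* con ½) refl x ⟩
  (x + x) * ½    ≡⟨ cong (λ y → (x + y) * ½) x≡-x ⟩
  (x + - x) * ½  ≡⟨ cong (_* ½) (ℚ.+-inverseʳ x) ⟩
  0ℚ             ∎

x*y≡0⇒x≡0 : ∀ {x y} → y ≢ 0ℚ → x * y ≡ 0ℚ → x ≡ 0ℚ
x*y≡0⇒x≡0 {x} {y} y≢0 xy≡0 = begin
  x               ≡⟨ sym (ℚ.*-identityʳ x) ⟩
  x * 1ℚ          ≡⟨ cong (x *_) (sym (ℚ.*-inverseʳ y)) ⟩
  x * (y * 1/ y)  ≡⟨ sym (ℚ.*-assoc x y (1/ y)) ⟩
  (x * y) * 1/ y  ≡⟨ cong (_* 1/ y) xy≡0 ⟩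
  0ℚ * 1/ y       ≡⟨ ℚ.*-zeroˡ (1/ y) ⟩
  0ℚ              ∎
  where instance _ = ≢-nonZero y≢0

*-≢0 : ∀ {x y} → x ≢ 0ℚ → y ≢ 0ℚ → x * y ≢ 0ℚ
*-≢0 x≢0 y≢0 = x≢0 ∘ x*y≡0⇒x≡0 y≢0

quotient : ∀ x {y} → y ≢ 0ℚ → Σ ℚ (λ q → q * y ≡ x)
quotient x {y} y≢0 = x * 1/ y , (begin
  (x * 1/ y) * y  ≡⟨ ℚ.*-assoc x (1/ y) y ⟩
  x * (1/ y * y)  ≡⟨ cong (x *_) (ℚ.*-inverseˡ y) ⟩
  x * 1ℚ          ≡⟨ ℚ.*-identityʳ x ⟩
  x               ∎)
  where instance _ = ≢-nonZero y≢0

x*x≥0 : ∀ x → 0ℚ ≤ x * x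
x*x≥0 x with ℚ.≤-total x 0ℚ
... | inj₁ x≤0 = ℚ.nonNegative⁻¹ (x * x)
  where instance _ = nonPositive x≤0
                 _ = ℚ.nonPos*nonPos⇒nonPos x x
... | inj₂ 0≤x = ℚ.nonNegative⁻¹ (x * x)
  where instance _ = nonNegative 0≤x
                 _ = ℚ.nonNeg*nonNeg⇒nonNeg x x

x*x≡0⇒x≡0 : ∀ x → x * x ≡ 0ℚ → x ≡ 0ℚ
x*x≡0⇒x≡0 x xx≡0 with x ℚ.≟ 0ℚ
... | yes x≡0 = x≡0
... | no  x≢0 = x*y≡0⇒x≡0 x≢0 xx≡0

nonNeg+nonNeg≡0⇒ˡ≡0 : ∀ {x y} → 0ℚ ≤ x → 0ℚ ≤ y → x + y ≡ 0ℚ → x ≡ 0ℚ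
nonNeg+nonNeg≡0⇒ˡ≡0 {x} {y} 0≤x 0≤y x+y≡0 = ℚ.≤-antisym x≤0 0≤x
  where
  x≤0 : x ≤ 0ℚ
  x≤0 = ℚ.≤-trans (ℚ.≤-reflexive (sym (ℚ.+-identityʳ x)))
                  (ℚ.≤-trans (ℚ.+-monoʳ-≤ x 0≤y) (ℚ.≤-reflexive x+y≡0))

·-self≥0 : ∀ {m} (y : Vecℚ m) → 0ℚ ≤ y · y
·-self≥0 {zero}  y = ℚ.≤-refl
·-self≥0 {suc m} y = ℚ.+-mono-≤ (x*x≥0 (y zero)) (·-self≥0 (y ∘ suc))

·-self≡0⇒≡0 : ∀ {m} (y : Vecℚ m) → y · y ≡ 0ℚ → ∀ ρ → y ρ ≡ 0ℚ
·-self≡0⇒≡0 {suc m} y yy≡0 zero = x*x≡0⇒x≡0 (y zero)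
  (nonNeg+nonNeg≡0⇒ˡ≡0 (x*x≥0 (y zero)) (·-self≥0 (y ∘ suc)) yy≡0)
·-self≡0⇒≡0 {suc m} y yy≡0 (suc ρ) = ·-self≡0⇒≡0 (y ∘ suc)
  (nonNeg+nonNeg≡0⇒ˡ≡0 (·-self≥0 (y ∘ suc)) (x*x≥0 (y zero))
    (trans (ℚ.+-comm ((y ∘ suc) · (y ∘ suc)) (y zero * y zero)) yy≡0)) ρ

-x*-y≡x*y : ∀ x y → (- x) * (- y) ≡ x * y
-x*-y≡x*y = solve 2 (λ x y → (:- x) :* (:- y) := x :* y) refl

sign² : ∀ k → sign k * sign k ≡ 1ℚ
sign² zero    = refl
sign² (suc k) = trans (-x*-y≡x*y (sign k) (sign k)) (sign² k)

sign≢0 : ∀ k → sign k ≢ 0ℚ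
sign≢0 k sign≡0 with trans (sym (sign² k)) (trans (cong (_* sign k) sign≡0) (ℚ.*-zeroˡ (sign k)))
... | ()

det-cong : ∀ {n} {M M′ : Mat n n} → (∀ a b → M a b ≡ M′ a b) → det M ≡ det M′
det-cong {zero}  M≗M′ = refl
det-cong {suc n} M≗M′ = ∑-cong (λ j → cong₂ (λ x y → sign (toℕ j) * (x * y)) (M≗M′ zero j)
  (det-cong (λ a b → M≗M′ (suc a) (punchIn j b))))

punchIn-punchOut-comm : ∀ {n} (p q : Fin (suc (suc n))) (p≢q : p ≢ q) (q≢p : q ≢ p) (c : Fin n) →
  punchIn p (punchIn (punchOut p≢q) c) ≡ punchIn q (punchIn (punchOut q≢p) c)
punchIn-punchOut-comm zero    zero    p≢q q≢p c = ⊥-elim (p≢q refl)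
punchIn-punchOut-comm zero    (suc q) p≢q q≢p c = refl
punchIn-punchOut-comm (suc p) zero    p≢q q≢p c = refl
punchIn-punchOut-comm {zero}  (suc zero) (suc zero) p≢q q≢p c = ⊥-elim (p≢q refl)
punchIn-punchOut-comm {suc n} (suc p) (suc q) p≢q q≢p zero    = refl
punchIn-punchOut-comm {suc n} (suc p) (suc q) p≢q q≢p (suc c) =
  cong suc (punchIn-punchOut-comm p q (p≢q ∘ cong suc) (q≢p ∘ cong suc) c)

sign-punchOut : ∀ {n} (p q : Fin (suc (suc n))) (p≢q : p ≢ q) (q≢p : q ≢ p) →
  sign (toℕ q) * sign (toℕ (punchOut q≢p)) ≡ - (sign (toℕ p) * sign (toℕ (punchOut p≢q)))
sign-punchOut zero    zero    p≢q q≢p = ⊥-elim (p≢q refl)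
sign-punchOut zero    (suc q) p≢q q≢p =
  solve 1 (λ x → (:- x) :* con 1ℚ := :- (con 1ℚ :* x)) refl (sign (toℕ q))
sign-punchOut (suc p) zero    p≢q q≢p =
  solve 1 (λ x → con 1ℚ :* x := :- ((:- x) :* con 1ℚ)) refl (sign (toℕ p))
sign-punchOut {zero}  (suc zero) (suc zero) p≢q q≢p = ⊥-elim (p≢q refl)
sign-punchOut {suc n} (suc p) (suc q) p≢q q≢p = begin
  (- sign (toℕ q)) * (- sign (toℕ q′))  ≡⟨ -x*-y≡x*y (sign (toℕ q)) (sign (toℕ q′)) ⟩
  sign (toℕ q) * sign (toℕ q′)          ≡⟨ sign-punchOut p q (p≢q ∘ cong suc) (q≢p ∘ cong suc) ⟩
  - (sign (toℕ p) * sign (toℕ p′))      ≡⟨ cong -_ (-x*-y≡x*y (sign (toℕ p)) (sign (toℕ p′))) ⟨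
  - ((- sign (toℕ p)) * (- sign (toℕ p′))) ∎
  where
  p′ = punchOut (p≢q ∘ cong suc)
  q′ = punchOut (q≢p ∘ cong suc)

-- Expanding along the first two rows at once exhibits det as a bilinear form in
-- those rows whose coefficient matrix is antisymmetric.
module TwoRowExpansion {n : ℕ} (R : Fin n → Fin (suc (suc n)) → ℚ) where

  minor₂ : Fin (suc (suc n)) → Fin (suc n) → ℚ
  minor₂ j b = det (λ a c → R a (punchIn j (punchIn b c)))

  expand₂ : (A B : Fin (suc (suc n)) → ℚ) → ℚ
  expand₂ A B = ∑ (λ j → ∑ (λ b →
    sign (toℕ j) * (A j * (sign (toℕ b) * (B (punchIn j b) * minor₂ j b)))))

  coeff : Fin (suc (suc n)) → Fin (suc (suc n)) → ℚ
  coeff p q with p ≟ᶠ q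
  ... | yes _   = 0ℚ
  ... | no  p≢q = (sign (toℕ p) * sign (toℕ (punchOut p≢q))) * minor₂ p (punchOut p≢q)

  coeff-diag : ∀ p → coeff p p ≡ 0ℚ
  coeff-diag p with p ≟ᶠ p
  ... | yes _   = refl
  ... | no  p≢p = ⊥-elim (p≢p refl)

  coeff-punchIn : ∀ p b → coeff p (punchIn p b) ≡ (sign (toℕ p) * sign (toℕ b)) * minor₂ p b
  coeff-punchIn p b with p ≟ᶠ punchIn p b
  ... | yes p≡pb = ⊥-elim (punchInᵢ≢i p b (sym p≡pb))
  ... | no  p≢pb = cong (λ x → (sign (toℕ p) * sign (toℕ x)) * minor₂ p x)
    (trans (punchOut-cong p {i≢j = p≢pb} {i≢k = punchInᵢ≢i p b ∘ sym} refl) (punchOut-punchIn p))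

  coeff-antisym : ∀ p q → coeff q p ≡ - coeff p q
  coeff-antisym p q with p ≟ᶠ q | q ≟ᶠ p
  ... | yes _   | yes _   = refl
  ... | yes p≡q | no  q≢p = ⊥-elim (q≢p (sym p≡q))
  ... | no  p≢q | yes q≡p = ⊥-elim (p≢q (sym q≡p))
  ... | no  p≢q | no  q≢p = begin
    (sign (toℕ q) * sign (toℕ (punchOut q≢p))) * minor₂ q (punchOut q≢p)
      ≡⟨ cong₂ _*_ (sign-punchOut p q p≢q q≢p)
                   (det-cong (λ a c → cong (R a) (sym (punchIn-punchOut-comm p q p≢q q≢p c)))) ⟩
    (- (sign (toℕ p) * sign (toℕ (punchOut p≢q)))) * minor₂ p (punchOut p≢q)
      ≡⟨ ℚ.neg-distribˡ-* (sign (toℕ p) * sign (toℕ (punchOut p≢q))) (minor₂ p (punchOut p≢q)) ⟨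
    - ((sign (toℕ p) * sign (toℕ (punchOut p≢q))) * minor₂ p (punchOut p≢q)) ∎

  expand₂-bilinear : ∀ A B → expand₂ A B ≡ ∑ (λ p → ∑ (λ q → coeff p q * (A p * B q)))
  expand₂-bilinear A B = ∑-cong λ p → sym (begin
    ∑ (λ q → coeff p q * (A p * B q))
      ≡⟨ ∑-remove (λ q → coeff p q * (A p * B q)) p ⟩
    coeff p p * (A p * B p) + ∑ (λ b → coeff p (punchIn p b) * (A p * B (punchIn p b)))
      ≡⟨ cong₂ _+_ (trans (cong (_* (A p * B p)) (coeff-diag p)) (ℚ.*-zeroˡ (A p * B p)))
                   (∑-cong λ b → trans (cong (_* (A p * B (punchIn p b))) (coeff-punchIn p b))
                     (rearrange (sign (toℕ p)) (sign (toℕ b)) (minor₂ p b) (A p) (B (punchIn p b)))) ⟩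
    0ℚ + ∑ (λ b → sign (toℕ p) * (A p * (sign (toℕ b) * (B (punchIn p b) * minor₂ p b))))
      ≡⟨ ℚ.+-identityˡ _ ⟩
    ∑ (λ b → sign (toℕ p) * (A p * (sign (toℕ b) * (B (punchIn p b) * minor₂ p b)))) ∎)
    where
    rearrange : ∀ s t m a b → ((s * t) * m) * (a * b) ≡ s * (a * (t * (b * m)))
    rearrange = solve 5 (λ s t m a b → ((s :* t) :* m) :* (a :* b) := s :* (a :* (t :* (b :* m)))) refl

  expand₂-antisym : ∀ A B → expand₂ B A ≡ - expand₂ A B
  expand₂-antisym A B = begin
    expand₂ B A
      ≡⟨ expand₂-bilinear B A ⟩
    ∑ (λ p → ∑ (λ q → coeff p q * (B p * A q)))
      ≡⟨ ∑-comm (λ p q → coeff p q * (B p * A q)) ⟩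
    ∑ (λ q → ∑ (λ p → coeff p q * (B p * A q)))
      ≡⟨ ∑-cong (λ q → ∑-cong (λ p → trans (cong (_* (B p * A q)) (coeff-antisym q p))
           (flip-neg (coeff q p) (B p) (A q)))) ⟩
    ∑ (λ q → ∑ (λ p → - (coeff q p * (A q * B p))))
      ≡⟨ ∑-cong (λ q → ∑-neg (λ p → coeff q p * (A q * B p))) ⟩
    ∑ (λ q → - ∑ (λ p → coeff q p * (A q * B p)))
      ≡⟨ ∑-neg (λ q → ∑ (λ p → coeff q p * (A q * B p))) ⟩
    - ∑ (λ q → ∑ (λ p → coeff q p * (A q * B p)))
      ≡⟨ cong -_ (expand₂-bilinear A B) ⟨
    - expand₂ A B ∎
    where
    flip-neg : ∀ w x y → (- w) * (x * y) ≡ - (w * (y * x))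
    flip-neg = solve 3 (λ w x y → (:- w) :* (x :* y) := :- (w :* (y :* x))) refl

det-expand₂ : ∀ {n} (M : Mat (suc (suc n)) (suc (suc n))) →
              det M ≡ TwoRowExpansion.expand₂ (λ a → M (suc (suc a))) (M zero) (M (suc zero))
det-expand₂ M = ∑-cong λ j →
  trans (cong (sign (toℕ j) *_) (*-distribˡ-∑ (M zero j) (g j)))
        (*-distribˡ-∑ (sign (toℕ j)) (λ b → M zero j * g j b))
  where
  g : Fin _ → Fin _ → ℚ
  g j b = sign (toℕ b) * (M (suc zero) (punchIn j b) * det (λ a c → M (suc (suc a)) (punchIn j (punchIn b c))))

swap₀₁ : ∀ {n} {A : Set} → (Fin (suc (suc n)) → A) → Fin (suc (suc n)) → A
swap₀₁ M zero          = M (suc zero)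
swap₀₁ M (suc zero)    = M zero
swap₀₁ M (suc (suc a)) = M (suc (suc a))

det-swap₀₁ : ∀ {n} (M : Mat (suc (suc n)) (suc (suc n))) → det (swap₀₁ M) ≡ - det M
det-swap₀₁ M = trans (det-expand₂ (swap₀₁ M))
  (trans (TwoRowExpansion.expand₂-antisym (λ a → M (suc (suc a))) (M zero) (M (suc zero)))
         (cong -_ (sym (det-expand₂ M))))

-x≡y⇒x≡-y : ∀ {x y} → - x ≡ y → x ≡ - y
-x≡y⇒x≡-y {x} refl = sym (solve 1 (λ x → :- (:- x) := x) refl x)

det-row₀≡row : ∀ {n} (M : Mat (suc n) (suc n)) a → (∀ c → M zero c ≡ M (suc a) c) → det M ≡ 0ℚ
det-row₀≡row {suc n} M zero row₀≡row₁ = x≡-x⇒x≡0 (det M) (trans (det-cong M≗swap) (det-swap₀₁ M))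
  where
  M≗swap : ∀ a c → M a c ≡ swap₀₁ M a c
  M≗swap zero          c = row₀≡row₁ c
  M≗swap (suc zero)    c = sym (row₀≡row₁ c)
  M≗swap (suc (suc a)) c = refl
det-row₀≡row {suc n} M (suc a) row₀≡row = -x≡y⇒x≡-y (begin
  - det M        ≡⟨ det-swap₀₁ M ⟨
  det (swap₀₁ M) ≡⟨ ∑-zero (λ j → trans
                      (cong (λ x → sign (toℕ j) * (M (suc zero) j * x)) (minor≡0 j))
                      (trans (cong (sign (toℕ j) *_) (ℚ.*-zeroʳ (M (suc zero) j))) (ℚ.*-zeroʳ (sign (toℕ j))))) ⟩
  0ℚ             ∎)
  where
  minor≡0 : ∀ j → det (λ x c → swap₀₁ M (suc x) (punchIn j c)) ≡ 0ℚ
  minor≡0 j = det-row₀≡row (λ x c → swap₀₁ M (suc x) (punchIn j c)) a (row₀≡row ∘ punchIn j)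

det-rowToTop : ∀ {n} (M : Mat (suc n) (suc n)) i → det (M i ∷ removeAt M i) ≡ sign (toℕ i) * det M
det-rowToTop M zero = trans (det-cong M≗M) (sym (ℚ.*-identityˡ (det M)))
  where
  M≗M : ∀ a c → (M zero ∷ removeAt M zero) a c ≡ M a c
  M≗M zero    c = refl
  M≗M (suc a) c = refl
det-rowToTop {suc n} M (suc i) = trans (-x≡y⇒x≡-y (begin
  - det X                                                   ≡⟨ det-swap₀₁ X ⟨
  det (swap₀₁ X)                                            ≡⟨ ∑-cong (λ j → cong (λ x → sign (toℕ j) * (M zero j * x)) (minor j)) ⟩
  ∑ (λ j → sign (toℕ j) * (M zero j * (sᵢ * det (M′ j))))  ≡⟨ ∑-cong (λ j → pull-out (sign (toℕ j)) (M zero j) sᵢ (det (M′ j))) ⟩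
  ∑ (λ j → sᵢ * (sign (toℕ j) * (M zero j * det (M′ j))))  ≡⟨ *-distribˡ-∑ sᵢ (λ j → sign (toℕ j) * (M zero j * det (M′ j))) ⟨
  sᵢ * det M                                                ∎))
  (ℚ.neg-distribˡ-* sᵢ (det M))
  where
  X  = M (suc i) ∷ removeAt M (suc i)
  sᵢ = sign (toℕ i)
  M′ : Fin (suc (suc n)) → Mat (suc n) (suc n)
  M′ j x c = M (suc x) (punchIn j c)
  minor : ∀ j → det (λ x c → swap₀₁ X (suc x) (punchIn j c)) ≡ sᵢ * det (M′ j)
  minor j = trans (det-cong minor≗) (det-rowToTop (M′ j) i)
    where
    minor≗ : ∀ a c → swap₀₁ X (suc a) (punchIn j c) ≡ (M′ j i ∷ removeAt (M′ j) i) a c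
    minor≗ zero    c = refl
    minor≗ (suc a) c = refl
  pull-out : ∀ s m t d → s * (m * (t * d)) ≡ t * (s * (m * d))
  pull-out = solve 4 (λ s m t d → s :* (m :* (t :* d)) := t :* (s :* (m :* d))) refl

cofactor : ∀ {n} (M : Mat (suc n) (suc n)) (i j : Fin (suc n)) → ℚ
cofactor M i j = sign (suc (toℕ j)) * det (λ a b → M (punchIn i a) (punchIn j b))

cofactor-expansion-with-row : ∀ {n} (M : Mat (suc n) (suc n)) i k →
  ∑ (λ j → cofactor M i j * M k j) ≡ - det (M k ∷ removeAt M i)
cofactor-expansion-with-row M i k = trans
  (∑-cong (λ j → rearrange (sign (toℕ j)) (det (λ a b → M (punchIn i a) (punchIn j b))) (M k j)))
  (∑-neg (λ j → sign (toℕ j) * (M k j * det (λ a b → M (punchIn i a) (punchIn j b)))))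
  where
  rearrange : ∀ s d m → ((- s) * d) * m ≡ - (s * (m * d))
  rearrange = solve 3 (λ s d m → ((:- s) :* d) :* m := :- (s :* (m :* d))) refl

cofactor-expansion : ∀ {n} (M : Mat (suc n) (suc n)) i →
  ∑ (λ j → cofactor M i j * M i j) ≡ sign (suc (toℕ i)) * det M
cofactor-expansion M i = begin
  ∑ (λ j → cofactor M i j * M i j)  ≡⟨ cofactor-expansion-with-row M i i ⟩
  - det (M i ∷ removeAt M i)        ≡⟨ cong -_ (det-rowToTop M i) ⟩
  - (sign (toℕ i) * det M)          ≡⟨ ℚ.neg-distribˡ-* (sign (toℕ i)) (det M) ⟩
  sign (suc (toℕ i)) * det M        ∎

alien-cofactor-expansion : ∀ {n} (M : Mat (suc n) (suc n)) i k → i ≢ k →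
  ∑ (λ j → cofactor M i j * M k j) ≡ 0ℚ
alien-cofactor-expansion M i k i≢k = begin
  ∑ (λ j → cofactor M i j * M k j)  ≡⟨ cofactor-expansion-with-row M i k ⟩
  - det (M k ∷ removeAt M i)        ≡⟨ cong -_ (det-row₀≡row (M k ∷ removeAt M i) (punchOut i≢k)
                                         (λ c → cong (λ r → M r c) (sym (punchIn-punchOut i≢k)))) ⟩
  - 0ℚ                              ≡⟨⟩
  0ℚ                                ∎

Gram : ∀ {r m} → (Fin r → Vecℚ m) → Mat r r
Gram v a b = v a · v b

Gram-injective : ∀ {r m} (v : Fin r → Vecℚ m) → LinIndep v → ∀ c →
  (∀ k → ∑ (λ j → c j * Gram v k j) ≡ 0ℚ) → ∀ j → c j ≡ 0ℚ
Gram-injective v indep c Gc≡0 = indep c (·-self≡0⇒≡0 y y·y≡0)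
  where
  y = lincomb c v
  y·y≡0 : y · y ≡ 0ℚ
  y·y≡0 = begin
    y · y                      ≡⟨ ·-lincombˡ c v y ⟩
    ∑ (λ k → c k * (v k · y))  ≡⟨ ∑-zero (λ k → trans (cong (c k *_) (trans (·-lincombʳ (v k) c v) (Gc≡0 k)))
                                                      (ℚ.*-zeroʳ (c k))) ⟩
    0ℚ                         ∎

LinIndep-tail : ∀ {r m} (v : Fin (suc r) → Vecℚ m) → LinIndep v → LinIndep (v ∘ suc)
LinIndep-tail v indep c tail≡0 i =
  indep (0ℚ ∷ c) (λ x → cong₂ _+_ (ℚ.*-zeroˡ (v zero x)) (tail≡0 x)) (suc i)

-- If det G = 0, the first cofactor row of G lies in the kernel of G and so vanishes;
-- its first entry is -det of the Gram matrix of the remaining vectors.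
det-Gram≢0 : ∀ {r m} (v : Fin r → Vecℚ m) → LinIndep v → det (Gram v) ≢ 0ℚ
det-Gram≢0 {zero}  v indep ()
det-Gram≢0 {suc r} v indep det≡0 =
  *-≢0 (sign≢0 1) (det-Gram≢0 (v ∘ suc) (LinIndep-tail v indep))
    (Gram-injective v indep (cofactor (Gram v) zero) cofactors-in-kernel zero)
  where
  cofactors-in-kernel : ∀ k → ∑ (λ j → cofactor (Gram v) zero j * Gram v k j) ≡ 0ℚ
  cofactors-in-kernel zero    = trans (cofactor-expansion (Gram v) zero)
                                      (trans (cong (sign 1 *_) det≡0) (ℚ.*-zeroʳ (sign 1)))
  cofactors-in-kernel (suc k) = alien-cofactor-expansion (Gram v) zero (suc k) (λ ())

unit : ∀ {n} → Fin n → Vecℚ n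
unit x σ with σ ≟ᶠ x
... | yes _ = 1ℚ
... | no  _ = 0ℚ

lincomb-unit : ∀ {k n} (v : Fin k → Vecℚ n) x ρ → lincomb (unit x) v ρ ≡ v x ρ
lincomb-unit v x ρ = trans (∑-supported-at (λ σ → unit x σ * v σ ρ) x off-x) at-x
  where
  off-x : ∀ σ → σ ≢ x → unit x σ * v σ ρ ≡ 0ℚ
  off-x σ σ≢x with σ ≟ᶠ x
  ... | yes σ≡x = ⊥-elim (σ≢x σ≡x)
  ... | no  _   = ℚ.*-zeroˡ (v σ ρ)
  at-x : unit x x * v x ρ ≡ v x ρ
  at-x with x ≟ᶠ x
  ... | yes _   = ℚ.*-identityˡ (v x ρ)
  ... | no  x≢x = ⊥-elim (x≢x refl)

module _ {d : ℕ} (Σc : CellComplex d) where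

  lincomb-Cut : ∀ {k} (c : Fin k → ℚ) (v : Fin k → Vecℚ (nF Σc)) →
                (∀ i → Cut Σc (v i)) → Cut Σc (lincomb c v)
  lincomb-Cut c v v-Cut = lincomb c w , λ σ → begin
    ∑ (λ i → c i * v i σ)               ≡⟨ ∑-cong (λ i → cong (c i *_) (proj₂ (v-Cut i) σ)) ⟩
    ∑ (λ i → c i * (∂col Σc σ · w i))   ≡⟨ ·-lincombʳ (∂col Σc σ) c w ⟨
    ∂col Σc σ · lincomb c w             ∎
    where
    w : Fin _ → Vecℚ (nR Σc)
    w i = proj₁ (v-Cut i)

  LduOn-Cut : ∀ σ → Cut Σc (LduOn Σc σ)
  LduOn-Cut σ = ∂col Σc σ , λ τ → refl

  module _ {r : ℕ} {Υ : Fin r → Fin (nF Σc)} (csf : IsCSF Σc Υ) where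

    Cut-≡-on-forest : ∀ {u u′} → Cut Σc u → Cut Σc u′ →
                      (∀ k → u (Υ k) ≡ u′ (Υ k)) → ∀ σ → u σ ≡ u′ σ
    Cut-≡-on-forest {u} {u′} u-Cut u′-Cut u≗u′ σ = begin
      u σ                           ≡⟨ expand u-Cut ⟩
      ∑ (λ j → b j * u (Υ j))       ≡⟨ ∑-cong (λ j → cong (b j *_) (u≗u′ j)) ⟩
      ∑ (λ j → b j * u′ (Υ j))      ≡⟨ expand u′-Cut ⟨
      u′ σ                          ∎
      where
      ∂σ-in-span = proj₂ (proj₂ csf) (∂col Σc σ) (unit σ , λ ρ → sym (lincomb-unit (∂col Σc) σ ρ))
      b = proj₁ ∂σ-in-span
      expand : ∀ {v} → Cut Σc v → v σ ≡ ∑ (λ j → b j * v (Υ j))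
      expand {v} (w , v≡∂*w) = begin
        v σ                                     ≡⟨ v≡∂*w σ ⟩
        ∂col Σc σ · w                           ≡⟨ ·-congˡ w (proj₂ ∂σ-in-span) ⟩
        lincomb b (∂col Σc ∘ Υ) · w             ≡⟨ ·-lincombˡ b (∂col Σc ∘ Υ) w ⟩
        ∑ (λ j → b j * (∂col Σc (Υ j) · w))     ≡⟨ ∑-cong (λ j → cong (b j *_) (v≡∂*w (Υ j))) ⟨
        ∑ (λ j → b j * v (Υ j))                 ∎

    basis-of-Cut : (χ : Fin r → Vecℚ (nF Σc)) → (∀ i → Cut Σc (χ i)) →
                   (∀ i k → i ≢ k → χ i (Υ k) ≡ 0ℚ) → (∀ k → χ k (Υ k) ≢ 0ℚ) →
                   IsBasisOf (Cut Σc) χ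
    basis-of-Cut χ χ-Cut χ-off χ-diag = χ-Cut , independent , spanning
      where
      lincomb-on-forest : ∀ c k → lincomb c χ (Υ k) ≡ c k * χ k (Υ k)
      lincomb-on-forest c k = ∑-supported-at (λ i → c i * χ i (Υ k)) k
        (λ i i≢k → trans (cong (c i *_) (χ-off i k i≢k)) (ℚ.*-zeroʳ (c i)))

      independent : LinIndep χ
      independent c lincomb≡0 k =
        x*y≡0⇒x≡0 (χ-diag k) (trans (sym (lincomb-on-forest c k)) (lincomb≡0 (Υ k)))

      spanning : ∀ u → Cut Σc u → Σ (Fin r → ℚ) (λ c → ∀ σ → u σ ≡ lincomb c χ σ)
      spanning u u-Cut = c , Cut-≡-on-forest u-Cut (lincomb-Cut c χ χ-Cut) agree
        where
        c : Fin r → ℚ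
        c k = proj₁ (quotient (u (Υ k)) (χ-diag k))
        agree : ∀ k → u (Υ k) ≡ lincomb c χ (Υ k)
        agree k = trans (sym (proj₂ (quotient (u (Υ k)) (χ-diag k)))) (sym (lincomb-on-forest c k))

-- Ldu restricted to Υ × Υ is definitionally Gram (∂col Σc ∘ Υ).
module _ {d : ℕ} (Σc : CellComplex d) {n : ℕ} (Υ : Fin (suc n) → Fin (nF Σc)) where

  χ̄-Cut : ∀ i → Cut Σc (χ̄ Σc Υ i)
  χ̄-Cut i = lincomb-Cut Σc (cofactor (Gram (∂col Σc ∘ Υ)) i) (LduOn Σc ∘ Υ) (LduOn-Cut Σc ∘ Υ)

  χ̄-off-forest : ∀ i k → i ≢ k → χ̄ Σc Υ i (Υ k) ≡ 0ℚ
  χ̄-off-forest = alien-cofactor-expansion (Gram (∂col Σc ∘ Υ))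

  χ̄-on-forest≢0 : LinIndep (∂col Σc ∘ Υ) → ∀ k → χ̄ Σc Υ k (Υ k) ≢ 0ℚ
  χ̄-on-forest≢0 indep k χ̄≡0 =
    *-≢0 (sign≢0 (suc (toℕ k))) (det-Gram≢0 (∂col Σc ∘ Υ) indep)
      (trans (sym (cofactor-expansion (Gram (∂col Σc ∘ Υ)) k)) χ̄≡0)

theorem4p7 : (d : ℕ) (Σc : CellComplex d) (r : ℕ)
    (Υ : Fin r → Fin (nF Σc)) → IsCSF Σc Υ →
    IsBasisOf (Cut Σc) (χ̄ Σc Υ)
theorem4p7 d Σc zero    Υ csf = basis-of-Cut Σc csf (χ̄ Σc Υ) (λ ()) (λ ()) (λ ())
theorem4p7 d Σc (suc n) Υ csf = basis-of-Cut Σc csf (χ̄ Σc Υ)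
  (χ̄-Cut Σc Υ) (χ̄-off-forest Σc Υ) (χ̄-on-forest≢0 Σc Υ (proj₁ (proj₂ csf)))
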